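{- Let $T(6)$ be the triangular graph on the $15$ two-element subsets of a $6$-set. Then $M(T(6))=4\mathbb{N}=\{4,8,12,\dots\}$, and hence the partition index of $T(6)$ equals $1$.
   Context: The triangular graph $T(l)$ is the line graph of $K_l$: its vertices are the $2$-element subsets of an $l$-set, two distinct vertices adjacent iff they have non-empty intersection. For a positive integer $m$, $mK_n$ denotes the $m$-fold complete multigraph on $n$ vertices. For a graph $G$ on $n$ vertices, $M(G)$ is the set of positive integers $m$ such that there is a finite list of graphs on a common $n$-element vertex set, each isomorphic to $G$, such that every pair of distinct vertices is an edge of exactly $m$ of them. The partition modulus $\mathrm{pm}(G)$ is $\gcd M(G)$. With $e$ the number of edges and $d$ the gcd of vertex degrees, $m_1(G)=\mathrm{lcm}\big(e/\gcd(e,n(n-1)/2),\ d/\gcd(d,n-1)\big)$, and the partition index is $\mathrm{pi}(G)=\mathrm{pm}(G)/m_1(G)$. -}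

module Defs where

open import Data.Nat using (ℕ; zero; suc; _+_; _*_; _∸_; _<_; _/_)
open import Data.Nat.Divisibility using (_∣_)
open import Data.Nat.GCD using (gcd)
open import Data.Nat.LCM using (lcm)
open import Data.Bool using (Bool; true; false; if_then_else_; _∧_; _∨_; not)
open import Data.Fin using (Fin; zero; suc; toℕ; _≟_)
open import Data.Fin.Permutation using (Permutation′; _⟨$⟩ʳ_)
open import Data.Vec using (Vec; []; _∷_; lookup)
open import Data.List using (List; []; _∷_; map; foldr; allFin)
open import Data.Nat.ListAction using (sum)
open import Data.Product using (Σ; _×_; _,_; proj₁)
open import Relation.Nullary.Decidable using (⌊_⌋)
open import Relation.Binary.PropositionalEquality using (_≡_; _≢_)

-- A (simple) graph on the vertex set Fin n, given by its adjacency predicate.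
-- (Only applied below to graphs that are loopless and symmetric.)
Graph : ℕ → Set
Graph n = Fin n → Fin n → Bool

Iso : ∀ {n} → Graph n → Graph n → Set
Iso {n} H G = Σ (Permutation′ n) λ σ → ∀ i j → H i j ≡ G (σ ⟨$⟩ʳ i) (σ ⟨$⟩ʳ j)

CopyOf : ∀ {n} → Graph n → Set
CopyOf {n} G = Σ (Graph n) (λ H → Iso H G)

edgeMult : ∀ {n} (G : Graph n) → List (CopyOf G) → Fin n → Fin n → ℕ
edgeMult G []             i j = 0
edgeMult G ((H , _) ∷ Hs) i j = (if H i j then 1 else 0) + edgeMult G Hs i j

-- m ∈ M(G): m positive and there is a finite list of graphs on Fin n, each
-- isomorphic to G, such that each pair of distinct vertices is an edge of
-- exactly m of them (i.e. a decomposition of mK_n into copies of G).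
InM : ∀ {n} → Graph n → ℕ → Set
InM {n} G m = (0 < m) × Σ (List (CopyOf G))
  (λ Hs → ∀ (i j : Fin n) → i ≢ j → edgeMult G Hs i j ≡ m)

IsPartitionModulus : ∀ {n} → Graph n → ℕ → Set
IsPartitionModulus G p =
  (∀ m → InM G m → p ∣ m) × (∀ c → (∀ m → InM G m → c ∣ m) → c ∣ p)

count : ∀ {n} → (Fin n → Bool) → ℕ
count {n} f = sum (map (λ i → if f i then 1 else 0) (allFin n))

degree : ∀ {n} → Graph n → Fin n → ℕ
degree G i = count (G i)

numEdges : ∀ {n} → Graph n → ℕ
numEdges {n} G = sum (map (λ i → count (λ j → ⌊ toℕ i Data.Nat.<? toℕ j ⌋ ∧ G i j)) (allFin n))

degGcd : ∀ {n} → Graph n → ℕ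
degGcd {n} G = foldr (λ i r → gcd (degree G i) r) 0 (allFin n)

-- total division (x div 0 = 0); only used with nonzero divisors below
_div_ : ℕ → ℕ → ℕ
x div zero    = 0
x div (suc k) = x / suc k

m₁ : ∀ {n} → Graph n → ℕ
m₁ {n} G = lcm (e div gcd e ((n * (n ∸ 1)) / 2)) (d div gcd d (n ∸ 1))
  where
    e = numEdges G
    d = degGcd G

pairs6 : Vec (Fin 6 × Fin 6) 15
pairs6 =
  (0F , 1F) ∷ (0F , 2F) ∷ (0F , 3F) ∷ (0F , 4F) ∷ (0F , 5F) ∷
  (1F , 2F) ∷ (1F , 3F) ∷ (1F , 4F) ∷ (1F , 5F) ∷
  (2F , 3F) ∷ (2F , 4F) ∷ (2F , 5F) ∷
  (3F , 4F) ∷ (3F , 5F) ∷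
  (4F , 5F) ∷ []
  where
    0F 1F 2F 3F 4F 5F : Fin 6
    0F = zero
    1F = suc zero
    2F = suc (suc zero)
    3F = suc (suc (suc zero))
    4F = suc (suc (suc (suc zero)))
    5F = suc (suc (suc (suc (suc zero))))

_==_ : Fin 6 → Fin 6 → Bool
a == b = ⌊ a ≟ b ⌋

meets : Fin 6 × Fin 6 → Fin 6 × Fin 6 → Bool
meets (a , b) (c , d) = (a == c) ∨ (a == d) ∨ (b == c) ∨ (b == d)

T6 : Graph 15
T6 u v = not ⌊ u ≟ v ⌋ ∧ meets (lookup pairs6 u) (lookup pairs6 v)

-- Count the pairs through one vertex of a decomposition of mK₁₅ into k copies
-- of T(6): each pair is covered m times, and each copy, being 8-regular, covers
-- 8 of them, so 14m = 8k and 4 ∣ m. Conversely seven relabellings of T(6) cover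
-- every pair exactly four times (7 · 60 = 4 · 105 edges), and repeating them
-- realises every multiple of 4. With e = 60 and d = 8, m₁(T(6)) = lcm(4, 4) = 4.
module Submission where

open import Defs
open import Data.Nat using (ℕ; _<_)
open import Data.Nat.Divisibility using (_∣_)
open import Data.Product using (Σ; _×_)
open import Function.Bundles using (_⇔_)
open import Relation.Binary.PropositionalEquality using (_≡_)

open import Data.Nat using (zero; suc; _+_; _*_; z<s)
open import Data.Nat.Properties using (+-0-commutativeMonoid; +-assoc; *-assoc)
import Data.Nat.Properties as ℕ
open import Data.Nat.Divisibility using (divides; *-cancelˡ-∣)
open import Data.Nat.Coprimality using (Coprime; coprime?; coprime-divisor)
open import Data.Bool using (Bool; false; if_then_else_)
import Data.Bool.Properties as Bool
open import Data.Fin using (Fin; zero; suc; _≟_; #_)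
open import Data.Fin.Properties using (all?)
open import Data.Fin.Permutation using (Permutation′; _⟨$⟩ʳ_; permutation)
open import Data.Vec using (Vec; []; _∷_; lookup)
open import Data.List using (List; []; _∷_; _++_; map; tabulate; length; concat; replicate)
open import Data.List.Properties using (map-tabulate)
open import Data.Nat.ListAction using (sum)
open import Data.Product using (_,_; proj₁)
open import Function.Base using (_∘_)
open import Function.Bundles using (mk⇔)
open import Relation.Binary.PropositionalEquality using (refl; sym; trans; cong; cong₂; subst; module ≡-Reasoning)
open import Relation.Nullary.Decidable using (True; toWitness; ¬?; _→-dec_)
open import Algebra.Properties.CommutativeMonoid.Sum +-0-commutativeMonoid
  using (∑-permute; ∑-distrib-+; sum-cong-≗; sum-replicate-zero) renaming (sum to ∑)

private
  variable
    n m r : ℕ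

Loopless : Graph n → Set
Loopless G = ∀ v → G v v ≡ false

Regular : ℕ → Graph n → Set
Regular r G = ∀ v → degree G v ≡ r

relabel : (G : Graph n) → Permutation′ n → CopyOf G
relabel G σ = (λ i j → G (σ ⟨$⟩ʳ i) (σ ⟨$⟩ʳ j)) , σ , λ _ _ → refl

permutationFromInverses : (t u : Vec (Fin n) n) →
  True (all? λ y → lookup t (lookup u y) ≟ y) →
  True (all? λ x → lookup u (lookup t x) ≟ x) → Permutation′ n
permutationFromInverses t u t∘u≡id u∘t≡id =
  permutation (lookup t) (lookup u) (toWitness t∘u≡id) (toWitness u∘t≡id)

sum-tabulate : (g : Fin n → ℕ) → sum (tabulate g) ≡ ∑ g
sum-tabulate {zero}  g = refl
sum-tabulate {suc n} g = cong (g zero +_) (sum-tabulate (g ∘ suc))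

∑-const : ∀ n m → ∑ {n} (λ _ → m) ≡ n * m
∑-const zero    m = refl
∑-const (suc n) m = cong (m +_) (∑-const n m)

count≡∑ : (f : Fin n → Bool) → count f ≡ ∑ (λ i → if f i then 1 else 0)
count≡∑ f = trans (cong sum (map-tabulate (λ i → i) g)) (sum-tabulate g)
  where g = λ i → if f i then 1 else 0

degree-Iso : {H G : Graph n} (iso : Iso H G) → ∀ i → degree H i ≡ degree G (proj₁ iso ⟨$⟩ʳ i)
degree-Iso {H = H} {G} (σ , H≡Gσ) i = begin
  degree H i                                              ≡⟨ count≡∑ (H i) ⟩
  ∑ (λ j → if H i j then 1 else 0)                        ≡⟨ sum-cong-≗ (λ j → cong (if_then 1 else 0) (H≡Gσ i j)) ⟩
  ∑ (λ j → if G (σ ⟨$⟩ʳ i) (σ ⟨$⟩ʳ j) then 1 else 0)      ≡⟨ ∑-permute (λ k → if G (σ ⟨$⟩ʳ i) k then 1 else 0) σ ⟨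
  ∑ (λ k → if G (σ ⟨$⟩ʳ i) k then 1 else 0)               ≡⟨ count≡∑ (G (σ ⟨$⟩ʳ i)) ⟨
  degree G (σ ⟨$⟩ʳ i)                                     ∎
  where open ≡-Reasoning

Iso-regular : {H G : Graph n} → Iso H G → Regular r G → Regular r H
Iso-regular {G = G} iso G-reg i = trans (degree-Iso {G = G} iso i) (G-reg _)

Iso-loopless : {H G : Graph n} → Iso H G → Loopless G → Loopless H
Iso-loopless (σ , H≡Gσ) G-loopless i = trans (H≡Gσ i i) (G-loopless (σ ⟨$⟩ʳ i))

edgeMult-++ : (G : Graph n) (Hs Ks : List (CopyOf G)) → ∀ i j →
  edgeMult G (Hs ++ Ks) i j ≡ edgeMult G Hs i j + edgeMult G Ks i j
edgeMult-++ G []             Ks i j = refl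
edgeMult-++ G ((H , _) ∷ Hs) Ks i j =
  trans (cong ((if H i j then 1 else 0) +_) (edgeMult-++ G Hs Ks i j))
        (sym (+-assoc (if H i j then 1 else 0) _ _))

edgeMult-concat-replicate : (G : Graph n) (Hs : List (CopyOf G)) → ∀ q i j →
  edgeMult G (concat (replicate q Hs)) i j ≡ q * edgeMult G Hs i j
edgeMult-concat-replicate G Hs zero    i j = refl
edgeMult-concat-replicate G Hs (suc q) i j =
  trans (edgeMult-++ G Hs _ i j) (cong (edgeMult G Hs i j +_) (edgeMult-concat-replicate G Hs q i j))

edgeMult-diagonal : (G : Graph n) → Loopless G → (Hs : List (CopyOf G)) → ∀ i →
  edgeMult G Hs i i ≡ 0
edgeMult-diagonal G G-loopless []               i = refl
edgeMult-diagonal G G-loopless ((H , iso) ∷ Hs) i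
  rewrite Iso-loopless {G = G} iso G-loopless i = edgeMult-diagonal G G-loopless Hs i

∑-edgeMult : {G : Graph n} → Regular r G → (Hs : List (CopyOf G)) → ∀ i →
  ∑ (edgeMult G Hs i) ≡ length Hs * r
∑-edgeMult {n} G-reg [] i = sum-replicate-zero n
∑-edgeMult {r = r} {G = G} G-reg ((H , iso) ∷ Hs) i = begin
  ∑ (edgeMult G ((H , iso) ∷ Hs) i)                         ≡⟨ ∑-distrib-+ (λ j → if H i j then 1 else 0) _ ⟩
  ∑ (λ j → if H i j then 1 else 0) + ∑ (edgeMult G Hs i)    ≡⟨ cong (_+ ∑ (edgeMult G Hs i)) (count≡∑ (H i)) ⟨
  degree H i + ∑ (edgeMult G Hs i)                          ≡⟨ cong₂ _+_ (Iso-regular iso G-reg i) (∑-edgeMult G-reg Hs i) ⟩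
  r + length Hs * r                                         ∎
  where open ≡-Reasoning

InM-multiple : {G : Graph n} {k : ℕ} → InM G m → 0 < k → m ∣ k → InM G k
InM-multiple {G = G} (_ , Hs , Hs-covers) 0<k (divides q k≡q*m) =
  0<k , concat (replicate q Hs) , λ i j i≢j →
    trans (edgeMult-concat-replicate G Hs q i j) (trans (cong (q *_) (Hs-covers i j i≢j)) (sym k≡q*m))

InM-regular⇒∣ : {G : Graph (suc n)} → Loopless G → Regular r G → InM G m → r ∣ n * m
InM-regular⇒∣ {n} {r} {m} {G} G-loopless G-reg (_ , Hs , Hs-covers) = divides (length Hs) (begin
  n * m                                                      ≡⟨ ∑-const n m ⟨
  ∑ {n} (λ _ → m)                                            ≡⟨ sum-cong-≗ (λ j → Hs-covers zero (suc j) λ ()) ⟨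
  ∑ (edgeMult G Hs zero ∘ suc)                               ≡⟨ cong (_+ ∑ (edgeMult G Hs zero ∘ suc)) (edgeMult-diagonal G G-loopless Hs zero) ⟨
  ∑ (edgeMult G Hs zero)                                     ≡⟨ ∑-edgeMult G-reg Hs zero ⟩
  length Hs * r                                              ∎)
  where open ≡-Reasoning

isPartitionModulus : {G : Graph n} {p : ℕ} → InM G p → (∀ m → InM G m → p ∣ m) → IsPartitionModulus G p
isPartitionModulus p∈M p∣M = p∣M , λ c c∣M → c∣M _ p∈M

T6-loopless : Loopless T6
T6-loopless = toWitness {a? = all? λ v → T6 v v Bool.≟ false} _

T6-regular : Regular 8 T6
T6-regular = toWitness {a? = all? λ v → degree T6 v ℕ.≟ 8} _

T6-relabellings : List (Permutation′ 15)
T6-relabellings =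
  permutationFromInverses
    (# 0 ∷ # 9 ∷ # 14 ∷ # 10 ∷ # 13 ∷ # 12 ∷ # 11 ∷ # 4 ∷ # 8 ∷ # 7 ∷ # 3 ∷ # 6 ∷ # 2 ∷ # 5 ∷ # 1 ∷ [])
    (# 0 ∷ # 14 ∷ # 12 ∷ # 10 ∷ # 7 ∷ # 13 ∷ # 11 ∷ # 9 ∷ # 8 ∷ # 1 ∷ # 3 ∷ # 6 ∷ # 5 ∷ # 4 ∷ # 2 ∷ []) _ _ ∷
  permutationFromInverses
    (# 0 ∷ # 9 ∷ # 14 ∷ # 3 ∷ # 7 ∷ # 8 ∷ # 4 ∷ # 5 ∷ # 1 ∷ # 6 ∷ # 2 ∷ # 13 ∷ # 10 ∷ # 11 ∷ # 12 ∷ [])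
    (# 0 ∷ # 8 ∷ # 10 ∷ # 3 ∷ # 6 ∷ # 7 ∷ # 9 ∷ # 4 ∷ # 5 ∷ # 1 ∷ # 12 ∷ # 13 ∷ # 14 ∷ # 11 ∷ # 2 ∷ []) _ _ ∷
  permutationFromInverses
    (# 0 ∷ # 1 ∷ # 5 ∷ # 2 ∷ # 6 ∷ # 9 ∷ # 14 ∷ # 10 ∷ # 13 ∷ # 3 ∷ # 7 ∷ # 8 ∷ # 4 ∷ # 12 ∷ # 11 ∷ [])
    (# 0 ∷ # 1 ∷ # 3 ∷ # 9 ∷ # 12 ∷ # 2 ∷ # 4 ∷ # 10 ∷ # 11 ∷ # 5 ∷ # 7 ∷ # 14 ∷ # 13 ∷ # 8 ∷ # 6 ∷ []) _ _ ∷
  permutationFromInverses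
    (# 0 ∷ # 1 ∷ # 5 ∷ # 6 ∷ # 2 ∷ # 14 ∷ # 9 ∷ # 7 ∷ # 3 ∷ # 13 ∷ # 10 ∷ # 12 ∷ # 11 ∷ # 8 ∷ # 4 ∷ [])
    (# 0 ∷ # 1 ∷ # 4 ∷ # 8 ∷ # 14 ∷ # 2 ∷ # 3 ∷ # 7 ∷ # 13 ∷ # 6 ∷ # 10 ∷ # 12 ∷ # 11 ∷ # 9 ∷ # 5 ∷ []) _ _ ∷
  permutationFromInverses
    (# 0 ∷ # 1 ∷ # 5 ∷ # 9 ∷ # 14 ∷ # 2 ∷ # 6 ∷ # 12 ∷ # 11 ∷ # 8 ∷ # 4 ∷ # 10 ∷ # 13 ∷ # 3 ∷ # 7 ∷ [])
    (# 0 ∷ # 1 ∷ # 5 ∷ # 13 ∷ # 10 ∷ # 2 ∷ # 6 ∷ # 14 ∷ # 9 ∷ # 3 ∷ # 11 ∷ # 8 ∷ # 7 ∷ # 12 ∷ # 4 ∷ []) _ _ ∷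
  permutationFromInverses
    (# 0 ∷ # 1 ∷ # 5 ∷ # 12 ∷ # 11 ∷ # 8 ∷ # 4 ∷ # 2 ∷ # 6 ∷ # 9 ∷ # 14 ∷ # 3 ∷ # 7 ∷ # 10 ∷ # 13 ∷ [])
    (# 0 ∷ # 1 ∷ # 7 ∷ # 11 ∷ # 6 ∷ # 2 ∷ # 8 ∷ # 12 ∷ # 5 ∷ # 9 ∷ # 13 ∷ # 4 ∷ # 3 ∷ # 14 ∷ # 10 ∷ []) _ _ ∷
  permutationFromInverses
    (# 0 ∷ # 9 ∷ # 14 ∷ # 1 ∷ # 5 ∷ # 2 ∷ # 6 ∷ # 10 ∷ # 13 ∷ # 12 ∷ # 11 ∷ # 3 ∷ # 7 ∷ # 8 ∷ # 4 ∷ [])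
    (# 0 ∷ # 3 ∷ # 5 ∷ # 11 ∷ # 14 ∷ # 4 ∷ # 6 ∷ # 12 ∷ # 13 ∷ # 1 ∷ # 7 ∷ # 10 ∷ # 9 ∷ # 8 ∷ # 2 ∷ []) _ _ ∷
  []

T6-decomposition : List (CopyOf T6)
T6-decomposition = map (relabel T6) T6-relabellings

T6-4∈M : InM T6 4
T6-4∈M = z<s , T6-decomposition ,
  toWitness {a? = all? λ i → all? λ j → ¬? (i ≟ j) →-dec (edgeMult T6 T6-decomposition i j ℕ.≟ 4)} _

T6-M⊆4ℕ : ∀ m → InM T6 m → 4 ∣ m
T6-M⊆4ℕ m m∈M = coprime-divisor 4⊥7 (*-cancelˡ-∣ 2 2*4∣2*[7*m])
  where
    4⊥7 : Coprime 4 7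
    4⊥7 = toWitness {a? = coprime? 4 7} _
    2*4∣2*[7*m] : 2 * 4 ∣ 2 * (7 * m)
    2*4∣2*[7*m] = subst (2 * 4 ∣_) (*-assoc 2 7 m) (InM-regular⇒∣ T6-loopless T6-regular m∈M)

proposition8 : (∀ (m : ℕ) → InM T6 m ⇔ ((0 < m) × (4 ∣ m)))
    × Σ ℕ (λ p → IsPartitionModulus T6 p × p ≡ m₁ T6)
proposition8 =
  (λ m → mk⇔ (λ m∈M → proj₁ m∈M , T6-M⊆4ℕ m m∈M) (λ (0<m , 4∣m) → InM-multiple T6-4∈M 0<m 4∣m))
  , 4 , isPartitionModulus T6-4∈M T6-M⊆4ℕ , refl
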